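{- Let $n\ge1$, $\pi\in S_n$, and $c\in\mathcal{C}_{n,k}$, viewed as the colouring of $D_\pi$ in which edge $e_i$ receives colour $c(i)$. Then the reconstruction of $D_\pi$ according to $c$ is $\mathcal{R}(D_\pi,c)=D_{\pi\circ\alpha_c}$.
   Context: For a permutation $\pi$ of $\{1,\dots,n\}$, $D_\pi$ is the web diagram on $n+1$ pegs $D_\pi=\{e_i=(\pi(i),n+1,1,i):1\le i\le n\}$, where a 4-tuple $(x,y,a,b)$ is an edge from peg $x$ at height $a$ to peg $y$ at height $b$ (height 1 is the bottom). The sum of web diagrams is $D\oplus D'=D\cup\{(x',y',a'+p_{x'}(D),b'+p_{y'}(D)):(x',y',a',b')\in D'\}$, where $p_i(D)$ is the number of edge endpoints of $D$ on peg $i$ ($D'$ is placed on top of $D$). For a subset $X$ of a diagram, $\mathrm{rel}(X)$ relabels the heights of endpoints of edges of $X$ on each peg by $1,\dots,\ell_i$ preserving relative order. For a colouring $c$ (a surjection from edge indices onto $\{1,\dots,k\}$) with $D_c(t)$ the set of edges of colour $t$, $\mathcal{R}(D,c)=\mathrm{rel}(D_c(1))\oplus\cdots\oplus\mathrm{rel}(D_c(k))$. $\mathcal{C}_{n,k}$ is the set of sequences $(c(1),\dots,c(n))$ with $\{c(1),\dots,c(n)\}=\{1,\dots,k\}$. For $c\in\mathcal{C}_{n,k}$, $\alpha_c$ is the lexicographically smallest permutation of $\{1,\dots,n\}$ such that $c(\alpha_c(1))\le c(\alpha_c(2))\le\cdots\le c(\alpha_c(n))$ (list positions of colour 1 in increasing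 order, then of colour 2, etc.). -}

module Defs where

open import Data.Nat using (ℕ; zero; suc; _+_; _≤_; _<?_)
open import Data.Nat.Properties using (_≟_)
open import Data.Fin using (Fin; toℕ)
open import Data.Fin.Permutation using (Permutation′; _⟨$⟩ʳ_)
open import Data.List using (List; []; _∷_; _++_; map; filter; length; foldl; concatMap; upTo; allFin)
open import Data.List.Membership.Propositional using (_∈_)
open import Data.Product using (_×_; _,_; ∃)
open import Relation.Binary.PropositionalEquality using (_≡_)
open import Relation.Nullary.Decidable using (_×-dec_)
open import Function.Bundles using (_⇔_)

-- An edge (x , y , a , b): from peg x at height a to peg y at height b
-- (pegs and heights are positive naturals; height 1 is the bottom).
Edge : Set
Edge = ℕ × ℕ × ℕ × ℕ

Diagram : Set
Diagram = List Edge

_≈D_ : Diagram → Diagram → Set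
D ≈D D' = ∀ e → (e ∈ D) ⇔ (e ∈ D')

endpoints : Diagram → List (ℕ × ℕ)
endpoints = concatMap (λ { (x , y , a , b) → (x , a) ∷ (y , b) ∷ [] })

p : ℕ → Diagram → ℕ
p i D = length (filter (λ (e : ℕ × ℕ) → Data.Product.proj₁ e ≟ i) (endpoints D))

-- D ⊕ D' : D' placed on top of D
_⊕_ : Diagram → Diagram → Diagram
D ⊕ D' = D ++ map (λ { (x , y , a , b) → (x , y , a + p x D , b + p y D) }) D'

-- new height of an endpoint at height h on peg i of X after relabelling:
-- 1 + number of endpoints of X on peg i strictly below h
rank : Diagram → ℕ → ℕ → ℕ
rank X i h = suc (length (filter (λ (e : ℕ × ℕ) → (Data.Product.proj₁ e ≟ i) ×-dec (Data.Product.proj₂ e <? h)) (endpoints X)))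

rel : Diagram → Diagram
rel X = map (λ { (x , y , a , b) → (x , y , rank X x a , rank X y b) }) X

colours : ℕ → List ℕ
colours k = map suc (upTo k)

colourClass : {n : ℕ} → (Fin n → Edge) → (Fin n → ℕ) → ℕ → Diagram
colourClass {n} D c t = map D (filter (λ i → c i ≟ t) (allFin n))

reconstruct : {n : ℕ} → (Fin n → Edge) → (Fin n → ℕ) → ℕ → Diagram
reconstruct D c k = foldl (λ acc t → acc ⊕ rel (colourClass D c t)) [] (colours k)

IsColouring : (n k : ℕ) → (Fin n → ℕ) → Set
IsColouring n k c =
  (∀ i → (1 ≤ c i) × (c i ≤ k)) × (∀ t → 1 ≤ t → t ≤ k → ∃ λ i → c i ≡ t)

-- α_c in one-line notation (list of values α_c(1), …, α_c(n)):
-- positions of colour 1 in increasing order, then colour 2, etc.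
alpha : {n : ℕ} → (Fin n → ℕ) → ℕ → List (Fin n)
alpha {n} c k = concatMap (λ t → filter (λ i → c i ≟ t) (allFin n)) (colours k)

edgeπ : {n : ℕ} → Permutation′ n → Fin n → Edge
edgeπ {n} π i = (suc (toℕ (π ⟨$⟩ʳ i)) , suc n , 1 , suc (toℕ i))

Dπ : {n : ℕ} → Permutation′ n → Fin n → Edge
Dπ π = edgeπ π

-- D_w for a word w = w(1) … w(m) over Fin n given in one-line notation:
-- edges (w(j), n+1, 1, j)
wordDiagramFrom : (n : ℕ) → ℕ → List (Fin n) → Diagram
wordDiagramFrom n j [] = []
wordDiagramFrom n j (w ∷ ws) = (suc (toℕ w) , suc n , 1 , j) ∷ wordDiagramFrom n (suc j) ws

wordDiagram : (n : ℕ) → List (Fin n) → Diagram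
wordDiagram n w = wordDiagramFrom n 1 w

Dπα : {n : ℕ} → Permutation′ n → (Fin n → ℕ) → ℕ → Diagram
Dπα {n} π c k = wordDiagram n (map (π ⟨$⟩ʳ_) (alpha c k))

module Submission where

-- Write D_w for the "word diagram" of a word w = w(1)…w(m) over {1,…,n}:
-- its j-th edge runs from peg w(j) at height 1 to the top peg n+1 at height j.
-- Thus D_π = D_w for w = π(1)…π(n), and the claim is R(D_π, c) = D_{π∘α_c}.
-- The proof rests on two facts about word diagrams.
--   * Relabelling: if L = i₁ < ⋯ < i_m is an increasing list of indices, the
--     sub-diagram {e_i : i ∈ L} of D_π relabels to D_{π(i₁)…π(i_m)}: every
--     source stays at height 1, and on the top peg e_{i_j} has exactly j-1
--     endpoints below it.
--   * Stacking: D_u ⊕ D_v = D_{uv} when no letter of v occurs in u, since each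
--     source of D_v lands on an empty peg of D_u, while the top peg carries
--     length u endpoints of D_u.
-- Both rest on counting endpoints of a diagram with a given property.  The
-- theorem then follows by induction on k: the colour class of k+1 is an
-- increasing list of indices whose π-images are fresh for π∘α_c restricted to
-- colours ≤ k.

open import Defs
open import Data.Nat using (ℕ; zero; suc; _+_; _≤_; _<_; _<?_; s≤s; z≤n)
open import Data.Nat.Properties
  using (_≟_; +-identityʳ; +-suc; +-comm; suc-injective; <-irrefl; ≤⇒≯; <⇒≤; ≤-refl; <-≤-trans; ≤-reflexive; m≤n⇒m≤1+n)
open import Data.Fin using (Fin; toℕ)
open import Data.Fin.Properties using (toℕ<n; toℕ-injective)
open import Data.Fin.Permutation using (Permutation′; _⟨$⟩ʳ_)
open import Data.List using (List; []; _∷_; _++_; [_]; map; filter; length; foldl; concatMap; upTo; applyUpTo; allFin)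
open import Data.List.Properties
  using (filter-accept; filter-reject; filter-++; length-++; length-map; ++-assoc; ++-identityʳ; map-++; concatMap-++; foldl-∷ʳ; applyUpTo-∷ʳ)
open import Data.List.Relation.Unary.All using (All; []; _∷_)
import Data.List.Relation.Unary.All as All
import Data.List.Relation.Unary.All.Properties as AllProperties
open import Data.List.Relation.Unary.AllPairs using (AllPairs; _∷_)
import Data.List.Relation.Unary.AllPairs.Properties as AllPairsProperties
open import Data.Product using (_×_; _,_; proj₁; proj₂)
open import Data.Unit using (⊤; tt)
open import Function.Base using (id)
open import Function.Bundles using (Injection)
open import Function.Definitions using (Injective)
open import Function.Properties.Inverse using (↔⇒↣)
import Function.Properties.Equivalence as Equivalence
open import Relation.Binary.PropositionalEquality using (_≡_; _≢_; refl; sym; trans; cong; cong₂; module ≡-Reasoning)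
open import Relation.Nullary using (¬_)
open import Relation.Nullary.Decidable using (_×-dec_)
open import Relation.Unary using (Decidable)

open ≡-Reasoning

-- Counting the endpoints of a diagram that satisfy a decidable property P of
-- (peg , height) pairs; both p_i and rank are counts of this kind.
module EndpointCount {P : ℕ × ℕ → Set} (P? : Decidable P) where

  count : Diagram → ℕ
  count X = length (filter P? (endpoints X))

  count-++ : ∀ X Y → count (X ++ Y) ≡ count X + count Y
  count-++ X Y = begin
    length (filter P? (endpoints (X ++ Y)))
      ≡⟨ cong (λ es → length (filter P? es)) (concatMap-++ _ X Y) ⟩
    length (filter P? (endpoints X ++ endpoints Y))
      ≡⟨ cong length (filter-++ P? (endpoints X) (endpoints Y)) ⟩
    length (filter P? (endpoints X) ++ filter P? (endpoints Y))
      ≡⟨ length-++ (filter P? (endpoints X)) ⟩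
    count X + count Y ∎

  Avoids : Edge → Set
  Avoids (x , y , a , b) = ¬ P (x , a) × ¬ P (y , b)

  count-none : ∀ {X} → All Avoids X → count X ≡ 0
  count-none [] = refl
  count-none ((¬source , ¬target) ∷ rest) =
    trans (cong length (filter-reject P? ¬source))
      (trans (cong length (filter-reject P? ¬target)) (count-none rest))

  TargetOnly : Edge → Set
  TargetOnly (x , y , a , b) = ¬ P (x , a) × P (y , b)

  count-targets : ∀ {X} → All TargetOnly X → count X ≡ length X
  count-targets [] = refl
  count-targets ((¬source , target) ∷ rest) =
    trans (cong length (filter-reject P? ¬source))
      (trans (cong length (filter-accept P? target)) (cong suc (count-targets rest)))

-- The endpoints of a diagram strictly below height h on peg x;
-- by definition rank X x h ≡ suc (below x h X).
module Below (x h : ℕ) = EndpointCount (λ (e : ℕ × ℕ) → (proj₁ e ≟ x) ×-dec (proj₂ e <? h))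

-- The endpoints of a diagram on peg i; by definition p i X ≡ onPeg i X.
module OnPeg (i : ℕ) = EndpointCount (λ (e : ℕ × ℕ) → proj₁ e ≟ i)

PositiveHeights : Edge → Set
PositiveHeights (_ , _ , a , b) = 1 ≤ a × 1 ≤ b

rank-bottom : ∀ X x → All PositiveHeights X → rank X x 1 ≡ 1
rank-bottom X x positive = cong suc (Below.count-none x 1 (All.map notBelow positive))
  where
  notBelow : ∀ {e} → PositiveHeights e → Below.Avoids x 1 e
  notBelow (1≤a , 1≤b) = (λ (_ , a<1) → ≤⇒≯ 1≤a a<1) , (λ (_ , b<1) → ≤⇒≯ 1≤b b<1)

-- Word diagrams D_w over the letters Fin n (letter w sits on peg 1 + toℕ w).
module Words {n : ℕ} where

  wordEdge : Fin n → ℕ → Edge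
  wordEdge w j = (suc (toℕ w) , suc n , 1 , j)

  letter≢top : ∀ (w : Fin n) → suc (toℕ w) ≢ suc n
  letter≢top w eq = <-irrefl (suc-injective eq) (toℕ<n w)

  wordDiagramFrom-++ : ∀ j (u v : List (Fin n)) →
    wordDiagramFrom n j (u ++ v) ≡ wordDiagramFrom n j u ++ wordDiagramFrom n (j + length u) v
  wordDiagramFrom-++ j [] v = cong (λ j′ → wordDiagramFrom n j′ v) (sym (+-identityʳ j))
  wordDiagramFrom-++ j (w ∷ u) v = cong (wordEdge w j ∷_) (begin
    wordDiagramFrom n (suc j) (u ++ v)
      ≡⟨ wordDiagramFrom-++ (suc j) u v ⟩
    wordDiagramFrom n (suc j) u ++ wordDiagramFrom n (suc j + length u) v
      ≡⟨ cong (λ j′ → wordDiagramFrom n (suc j) u ++ wordDiagramFrom n j′ v) (sym (+-suc j (length u))) ⟩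
    wordDiagramFrom n (suc j) u ++ wordDiagramFrom n (j + suc (length u)) v ∎)

  All-wordDiagramFrom : ∀ {Q : Fin n → Set} {R : Edge → Set} →
    (∀ {w} j → Q w → R (wordEdge w j)) → ∀ {ws} → All Q ws → ∀ j → All R (wordDiagramFrom n j ws)
  All-wordDiagramFrom edge [] j = []
  All-wordDiagramFrom edge (q ∷ qs) j = edge j q ∷ All-wordDiagramFrom edge qs (suc j)

  -- Every edge of D_w has exactly its target on the top peg.
  p-top : ∀ j ws → p (suc n) (wordDiagramFrom n j ws) ≡ length ws
  p-top j ws = trans (OnPeg.count-targets (suc n) edges) (lengthFrom j ws)
    where
    edges : All (OnPeg.TargetOnly (suc n)) (wordDiagramFrom n j ws)
    edges = All-wordDiagramFrom {Q = λ _ → ⊤} (λ {w} _ _ → letter≢top w , refl) (All.universal (λ _ → tt) ws) j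
    lengthFrom : ∀ j ws → length (wordDiagramFrom n j ws) ≡ length ws
    lengthFrom j [] = refl
    lengthFrom j (w ∷ ws) = cong suc (lengthFrom (suc j) ws)

  p-absent : ∀ {v : Fin n} j {ws} → All (_≢ v) ws → p (suc (toℕ v)) (wordDiagramFrom n j ws) ≡ 0
  p-absent {v} j absent = OnPeg.count-none (suc (toℕ v)) (All-wordDiagramFrom avoids absent j)
    where
    avoids : ∀ {w} j → w ≢ v → OnPeg.Avoids (suc (toℕ v)) (wordEdge w j)
    avoids j w≢v = (λ eq → w≢v (toℕ-injective (suc-injective eq))) , (λ eq → letter≢top v (sym eq))

  map-shift : (h : Edge → Edge) (m : ℕ) {ws : List (Fin n)} →
    All (λ w → ∀ j → h (wordEdge w j) ≡ wordEdge w (j + m)) ws →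
    ∀ j → map h (wordDiagramFrom n j ws) ≡ wordDiagramFrom n (j + m) ws
  map-shift h m [] j = refl
  map-shift h m (shifted ∷ rest) j = cong₂ _∷_ (shifted j) (map-shift h m rest (suc j))

  wordDiagram-⊕ : ∀ u v → All (λ w → All (_≢ w) u) v →
    wordDiagram n u ⊕ wordDiagram n v ≡ wordDiagram n (u ++ v)
  wordDiagram-⊕ u v fresh = begin
    wordDiagram n u ⊕ wordDiagram n v
      ≡⟨ cong (wordDiagram n u ++_) (map-shift _ (length u) (All.map shifted fresh) 1) ⟩
    wordDiagram n u ++ wordDiagramFrom n (1 + length u) v
      ≡⟨ sym (wordDiagramFrom-++ 1 u v) ⟩
    wordDiagram n (u ++ v) ∎
    where
    U = wordDiagram n u
    shifted : ∀ {w} → All (_≢ w) u → ∀ j →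
      (suc (toℕ w) , suc n , 1 + p (suc (toℕ w)) U , j + p (suc n) U) ≡ wordEdge w (j + length u)
    shifted {w} absent j =
      cong₂ (λ a b → (suc (toℕ w) , suc n , a , b)) (cong suc (p-absent 1 absent)) (cong (j +_) (p-top 1 u))

open Words

Increasing : ∀ {n} → List (Fin n) → Set
Increasing = AllPairs (λ a b → toℕ a < toℕ b)

module PermutationDiagram {n : ℕ} (π : Permutation′ n) where

  σ : Fin n → Fin n
  σ = π ⟨$⟩ʳ_

  σ-injective : Injective _≡_ _≡_ σ
  σ-injective = Injection.injective (↔⇒↣ π)

  -- e_i is the (i+1)-th edge of the word σ: Dπ π i ≡ wordEdge (σ i) (suc (toℕ i)).
  D : Fin n → Edge
  D = Dπ π

  -- In an increasing list P ++ i ∷ M, the edges of P lie below e_i on the top peg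
  -- and the edges of i ∷ M do not.
  rank-top : ∀ P i M → Increasing (P ++ i ∷ M) →
    rank (map D (P ++ i ∷ M)) (suc n) (suc (toℕ i)) ≡ suc (length P)
  rank-top P i M increasing = cong suc (begin
    count (map D (P ++ i ∷ M))
      ≡⟨ cong count (map-++ D P (i ∷ M)) ⟩
    count (map D P ++ map D (i ∷ M))
      ≡⟨ count-++ (map D P) (map D (i ∷ M)) ⟩
    count (map D P) + count (map D (i ∷ M))
      ≡⟨ cong₂ _+_ (count-targets (AllProperties.map⁺ (All.map earlier before)))
                   (count-none (AllProperties.map⁺ (All.map later after))) ⟩
    length (map D P) + 0
      ≡⟨ +-identityʳ _ ⟩
    length (map D P)
      ≡⟨ length-map D P ⟩
    length P ∎)
    where
    open Below (suc n) (suc (toℕ i))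
    split : ∀ prefix → Increasing (prefix ++ i ∷ M) →
      All (λ a → toℕ a < toℕ i) prefix × All (λ b → toℕ i ≤ toℕ b) (i ∷ M)
    split [] (i<M ∷ _) = [] , (≤-refl ∷ All.map <⇒≤ i<M)
    split (a ∷ prefix) (a<rest ∷ rest) with split prefix rest | AllProperties.++⁻ʳ prefix a<rest
    ... | (before , after) | (a<i ∷ _) = (a<i ∷ before) , after
    before : All (λ a → toℕ a < toℕ i) P
    before = proj₁ (split P increasing)
    after : All (λ b → toℕ i ≤ toℕ b) (i ∷ M)
    after = proj₂ (split P increasing)
    earlier : ∀ {a} → toℕ a < toℕ i → TargetOnly (D a)
    earlier {a} a<i = (λ (eq , _) → letter≢top (σ a) eq) , (refl , s≤s a<i)
    later : ∀ {b} → toℕ i ≤ toℕ b → Avoids (D b)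
    later {b} i≤b = (λ (eq , _) → letter≢top (σ b) eq) , (λ { (_ , s≤s b<i) → <-irrefl refl (<-≤-trans b<i i≤b) })

  map-byPosition : (h : Edge → Edge) (P L : List (Fin n)) →
    (∀ P′ i M → P ++ L ≡ P′ ++ i ∷ M → h (D i) ≡ wordEdge (σ i) (suc (length P′))) →
    map h (map D L) ≡ wordDiagramFrom n (suc (length P)) (map σ L)
  map-byPosition h P [] positioned = refl
  map-byPosition h P (i ∷ L) positioned = cong₂ _∷_ (positioned P i L refl) (begin
    map h (map D L)
      ≡⟨ map-byPosition h (P ++ [ i ]) L (λ P′ j M eq → positioned P′ j M (trans (sym (++-assoc P [ i ] L)) eq)) ⟩
    wordDiagramFrom n (suc (length (P ++ [ i ]))) (map σ L)
      ≡⟨ cong (λ ℓ → wordDiagramFrom n (suc ℓ) (map σ L)) (trans (length-++ P) (+-comm (length P) 1)) ⟩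
    wordDiagramFrom n (suc (suc (length P))) (map σ L) ∎)

  rel-increasing : ∀ L → Increasing L → rel (map D L) ≡ wordDiagram n (map σ L)
  rel-increasing L increasing = map-byPosition _ [] L positioned
    where
    positive : All PositiveHeights (map D L)
    positive = AllProperties.map⁺ (All.universal (λ _ → s≤s z≤n , s≤s z≤n) L)
    positioned : ∀ P i M → L ≡ P ++ i ∷ M →
      (suc (toℕ (σ i)) , suc n , rank (map D L) (suc (toℕ (σ i))) 1 , rank (map D L) (suc n) (suc (toℕ i)))
        ≡ wordEdge (σ i) (suc (length P))
    positioned P i M refl = cong₂ (λ a b → (suc (toℕ (σ i)) , suc n , a , b))
      (rank-bottom (map D L) (suc (toℕ (σ i))) positive) (rank-top P i M increasing)

module Colouring {n : ℕ} (c : Fin n → ℕ) where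

  class : ℕ → List (Fin n)
  class t = filter (λ i → c i ≟ t) (allFin n)

  class-increasing : ∀ t → Increasing (class t)
  class-increasing t = AllPairsProperties.filter⁺ (λ i → c i ≟ t) (AllPairsProperties.tabulate⁺-< id)

  class-colour : ∀ t → All (λ i → c i ≡ t) (class t)
  class-colour t = AllProperties.all-filter (λ i → c i ≟ t) (allFin n)

  colours-suc : ∀ k → colours (suc k) ≡ colours k ++ [ suc k ]
  colours-suc k = begin
    map suc (applyUpTo (λ x → x) (suc k))
      ≡⟨ cong (map suc) (sym (applyUpTo-∷ʳ (λ x → x) k)) ⟩
    map suc (upTo k ++ [ k ])
      ≡⟨ map-++ suc (upTo k) [ k ] ⟩
    colours k ++ [ suc k ] ∎

  alpha-suc : ∀ k → alpha c (suc k) ≡ alpha c k ++ class (suc k)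
  alpha-suc k = begin
    concatMap class (colours (suc k))
      ≡⟨ cong (concatMap class) (colours-suc k) ⟩
    concatMap class (colours k ++ [ suc k ])
      ≡⟨ concatMap-++ class (colours k) [ suc k ] ⟩
    alpha c k ++ class (suc k) ++ []
      ≡⟨ cong (alpha c k ++_) (++-identityʳ (class (suc k))) ⟩
    alpha c k ++ class (suc k) ∎

  alpha-bounded : ∀ k → All (λ i → c i ≤ k) (alpha c k)
  alpha-bounded zero = []
  alpha-bounded (suc k) rewrite alpha-suc k =
    AllProperties.++⁺ (All.map m≤n⇒m≤1+n (alpha-bounded k)) (All.map ≤-reflexive (class-colour (suc k)))

  reconstruct-suc : ∀ (E : Fin n → Edge) k →
    reconstruct E c (suc k) ≡ reconstruct E c k ⊕ rel (colourClass E c (suc k))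
  reconstruct-suc E k = trans (cong (foldl step []) (colours-suc k)) (foldl-∷ʳ step [] (suc k) (colours k))
    where
    step : Diagram → ℕ → Diagram
    step acc t = acc ⊕ rel (colourClass E c t)

class-fresh : ∀ {n} (π : Permutation′ n) (c : Fin n → ℕ) k →
  All (λ w → All (_≢ w) (map (π ⟨$⟩ʳ_) (alpha c k))) (map (π ⟨$⟩ʳ_) (Colouring.class c (suc k)))
class-fresh π c k = AllProperties.map⁺ (All.map fresh (Colouring.class-colour c (suc k)))
  where
  open PermutationDiagram π using (σ; σ-injective)
  -- indices listed so far have colour ≤ k, so differ from an index of colour k+1
  fresh : ∀ {i} → c i ≡ suc k → All (_≢ σ i) (map σ (alpha c k))
  fresh ci≡ = AllProperties.map⁺ (All.map (λ ca≤k eq → ≤⇒≯ ca≤k (≤-reflexive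
    (sym (trans (cong c (σ-injective eq)) ci≡)))) (Colouring.alpha-bounded c k))

reconstruct-Dπ : ∀ {n} (π : Permutation′ n) (c : Fin n → ℕ) k → reconstruct (Dπ π) c k ≡ Dπα π c k
reconstruct-Dπ π c zero = refl
reconstruct-Dπ {n} π c (suc k) = begin
  reconstruct D c (suc k)
    ≡⟨ reconstruct-suc D k ⟩
  reconstruct D c k ⊕ rel (map D (class (suc k)))
    ≡⟨ cong₂ _⊕_ (reconstruct-Dπ π c k) (rel-increasing _ (class-increasing (suc k))) ⟩
  wordDiagram n (map σ (alpha c k)) ⊕ wordDiagram n (map σ (class (suc k)))
    ≡⟨ wordDiagram-⊕ _ _ (class-fresh π c k) ⟩
  wordDiagram n (map σ (alpha c k) ++ map σ (class (suc k)))
    ≡⟨ cong (wordDiagram n) (sym (map-++ σ (alpha c k) (class (suc k)))) ⟩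
  wordDiagram n (map σ (alpha c k ++ class (suc k)))
    ≡⟨ cong (λ α → wordDiagram n (map σ α)) (sym (alpha-suc k)) ⟩
  Dπα π c (suc k) ∎
  where
  open PermutationDiagram π using (σ; D; rel-increasing)
  open Colouring c using (class; class-increasing; alpha-suc; reconstruct-suc)

lemma6p3 : (n k : ℕ) → 1 ≤ n → (π : Permutation′ n) → (c : Fin n → ℕ) →
    IsColouring n k c → reconstruct (Dπ π) c k ≈D Dπα π c k
lemma6p3 n k _ π c _ e rewrite reconstruct-Dπ π c k = Equivalence.refl
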